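{- Let $G=(V,E)$ be an acyclic transitive directed graph and let $S=(V,E_S)$ with $E_S\subseteq E$ be a 2-dimensional subgraph of $G$. Then the complement $\overline{S}$ of $S$ is transitively orientable, and for any transitive orientation $H_S$ of $\overline{S}$, letting $H:=H_S\cap\overline{G}$ (the edges of $H_S$ that are edges of the complement $\overline{G}$ of $G$), the graph $S':=G\setminus\mathcal{U}(H^*)$ (the graph on $V$ with edge set $E\setminus(E_H^*\cup(E_H^*)^{ -1})$, where $E_H^*$ is the edge set of the transitive closure $H^*$ of $H$) is 2-dimensional and satisfies $E_S\subseteq E(S')$.
   Context: All graphs are simple and directed; an undirected edge is represented as a pair of opposite directed edges. For $G=(V,E)$, $E^{ -1}=\{(b,a)\mid (a,b)\in E\}$, $\mathcal{U}(G)=(V,E\cup E^{ -1})$, and the complement of $G$ is $(V,\{(a,b)\mid a,b\in V,\ a\neq b\}\setminus (E\cup E^{ -1}))$. A graph is transitive if $(a,b),(b,c)\in E$ with $a\neq c$ implies $(a,c)\in E$; the transitive closure has as edge set the minimal transitive superset of the edge set. A graph $(V,E)$ is oriented if $E\cap E^{ -1}=\emptyset$; $(V,E')$ is an orientation of $(V,E)$ if $E'$ is a maximal oriented subset of $E$; a transitive orientation is an orientation that is transitive, and a graph is transitively orientable if it has one. An acyclic transitive graph is viewed as a strict partial order; it is 2-dimensional if its edge relation is the intersection of at most two linear orders on $V$. -}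

module Defs where

open import Data.Nat using (ℕ)
open import Data.Fin using (Fin)
open import Data.Bool using (Bool; true)
open import Data.Product using (Σ; _×_)
open import Data.Sum using (_⊎_)
open import Relation.Nullary using (¬_)
open import Relation.Binary.PropositionalEquality using (_≡_; _≢_)
open import Function.Bundles using (_⇔_)
open import Level using (Level; suc; zero)

BRel : ℕ → Set
BRel n = Fin n → Fin n → Bool

SRel : ℕ → Set₁
SRel n = Fin n → Fin n → Set

Ed : ∀ {n} → BRel n → SRel n
Ed R a b = R a b ≡ true

_⊆_ : ∀ {n} → SRel n → SRel n → Set
R ⊆ S = ∀ a b → R a b → S a b

Loopless : ∀ {n} → SRel n → Set
Loopless R = ∀ a → ¬ R a a

Compl : ∀ {n} → SRel n → SRel n
Compl R a b = a ≢ b × ¬ (R a b ⊎ R b a)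

-- Transitive in the paper's sense: (a,b),(b,c) ∈ E, a ≠ c ⇒ (a,c) ∈ E.
Transitive : ∀ {n} → SRel n → Set
Transitive R = ∀ a b c → R a b → R b c → a ≢ c → R a c

data TransClosure {n} (R : SRel n) : SRel n where
  step  : ∀ {a b} → R a b → TransClosure R a b
  trans : ∀ {a b c} → TransClosure R a b → TransClosure R b c → a ≢ c → TransClosure R a c

data Walk {n} (R : SRel n) : SRel n where
  edge : ∀ {a b} → R a b → Walk R a b
  cons : ∀ {a b c} → R a b → Walk R b c → Walk R a c

Acyclic : ∀ {n} → SRel n → Set
Acyclic R = ∀ a → ¬ Walk R a a

Oriented : ∀ {n} → SRel n → Set
Oriented R = ∀ a b → R a b → ¬ R b a

IsOrientation : ∀ {n} → SRel n → SRel n → Set₁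
IsOrientation {n} O E =
  (O ⊆ E) × Oriented O ×
  (∀ (F : SRel n) → O ⊆ F → F ⊆ E → Oriented F → F ⊆ O)

IsTransitiveOrientation : ∀ {n} → SRel n → SRel n → Set₁
IsTransitiveOrientation O E = IsOrientation O E × Transitive O

TransitivelyOrientable : ∀ {n} → SRel n → Set₁
TransitivelyOrientable {n} E = Σ (BRel n) λ O → IsTransitiveOrientation (Ed O) E

IsStrictLinearOrder : ∀ {n} → SRel n → Set
IsStrictLinearOrder L =
  (∀ a → ¬ L a a) × (∀ a b c → L a b → L b c → L a c) ×
  (∀ a b → a ≢ b → L a b ⊎ L b a)

-- 2-dimensional: edge relation = intersection of (at most) two linear orders
-- (one linear order L is the intersection of L with itself).
TwoDimensional : ∀ {n} → SRel n → Set
TwoDimensional {n} R =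
  Σ (BRel n) λ L₁ → Σ (BRel n) λ L₂ →
    IsStrictLinearOrder (Ed L₁) × IsStrictLinearOrder (Ed L₂) ×
    (∀ a b → R a b ⇔ (Ed L₁ a b × Ed L₂ a b))

Hof : ∀ {n} → BRel n → BRel n → SRel n
Hof G HS a b = Ed HS a b × Compl (Ed G) a b

S′of : ∀ {n} → BRel n → BRel n → SRel n
S′of G HS a b =
  Ed G a b × ¬ (TransClosure (Hof G HS) a b ⊎ TransClosure (Hof G HS) b a)

module Submission where

-- Everything rests on the conjugate criterion (Dushnik–Miller): if T is a
-- transitive oriented relation that is disjoint from a strict partial order P
-- and every pair of distinct vertices is related by P, P⁻¹, T or T⁻¹, then
-- P ∪ T and P ∪ T⁻¹ are strict linear orders whose intersection is P, so P is
-- 2-dimensional.  Conversely, if S = L₁ ∩ L₂ then L₁ ∩ L₂⁻¹ transitively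
-- orients the complement of S; this is the first half of the theorem.
--
-- For the second half, let H_S transitively orient the complement of S and
-- put H = H_S ∩ complement(G).  By maximality H_S directs every pair that is
-- incomparable in G.  A sweeping argument along walks of H shows that
-- S' = G \ U(H*) is transitive, and H* is a conjugate of S', so S' is
-- 2-dimensional.  Decidability of H* (needed to build Boolean linear orders)
-- comes from Warshall's algorithm on the finite vertex set.  Finally S ⊆ S'
-- because H* ⊆ H_S lies in the complement of S.

open import Defs
open import Data.Nat using (ℕ; zero; suc; _<_)
import Data.Nat as ℕ
open import Data.Nat.Properties using (m<1+n⇒m<n∨m≡n)
open import Data.Fin using (Fin; toℕ; _≟_)
open import Data.Fin.Properties using (toℕ-injective; toℕ<n; any?)
open import Data.Bool using (true)
open import Data.Bool.Properties using () renaming (_≟_ to _≟ᵇ_)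
open import Data.Product using (Σ; _×_; _,_; proj₁; proj₂)
open import Data.Sum using (_⊎_; inj₁; inj₂; [_,_]; swap; map₂) renaming (map to map-⊎)
open import Data.Empty using (⊥; ⊥-elim)
open import Function using (_∘_; flip)
open import Function.Bundles using (_⇔_; mk⇔; Equivalence)
open import Relation.Nullary using (¬_; Dec; yes; no)
open import Relation.Nullary.Decidable
  using (⌊_⌋; _×-dec_; _⊎-dec_; ¬?)
  renaming (map to map-dec)
open import Relation.Binary.PropositionalEquality
  using (_≡_; _≢_; refl; sym; subst) renaming (trans to ≡-trans)

open Equivalence using (to; from)

_≐_ : ∀ {n} → SRel n → SRel n → Set
R ≐ R′ = ∀ a b → R a b ⇔ R′ a b

Ed? : ∀ {n} (R : BRel n) → ∀ a b → Dec (Ed R a b)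
Ed? R a b = R a b ≟ᵇ true

toBRel : ∀ {n} {R : SRel n} → (∀ a b → Dec (R a b)) → BRel n
toBRel R? a b = ⌊ R? a b ⌋

Ed-toBRel : ∀ {n} {R : SRel n} (R? : ∀ a b → Dec (R a b)) → R ≐ Ed (toBRel R?)
Ed-toBRel R? a b with R? a b
... | yes r = mk⇔ (λ _ → refl) (λ _ → r)
... | no ¬r = mk⇔ (⊥-elim ∘ ¬r) (λ ())

-- Strict linear orders and transitive orientations are invariant under
-- pointwise equivalence, so they may be built on predicates and then booleanised.
linearOrder-resp : ∀ {n} {L L′ : SRel n} → L ≐ L′ →
  IsStrictLinearOrder L → IsStrictLinearOrder L′
linearOrder-resp {L = L} {L′} L≐L′ (irrefl , trans′ , total) =
    (λ a → irrefl a ∘ back a a)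
  , (λ a b c x y → to (L≐L′ a c) (trans′ a b c (back a b x) (back b c y)))
  , λ a b a≢b → map-⊎ (to (L≐L′ a b)) (to (L≐L′ b a)) (total a b a≢b)
  where
  back : ∀ a b → L′ a b → L a b
  back a b = from (L≐L′ a b)

transitiveOrientation-resp : ∀ {n} {O O′ E : SRel n} → O ≐ O′ →
  IsTransitiveOrientation O E → IsTransitiveOrientation O′ E
transitiveOrientation-resp {O = O} {O′} O≐O′ ((O⊆E , oriented , maximal) , trans′) =
    ( (λ a b → O⊆E a b ∘ back a b)
    , (λ a b x y → oriented a b (back a b x) (back b a y))
    , λ F O′⊆F F⊆E F-oriented a b f →
        to (O≐O′ a b) (maximal F (λ x y → O′⊆F x y ∘ to (O≐O′ x y)) F⊆E F-oriented a b f))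
  , λ a b c x y a≢c → to (O≐O′ a c) (trans′ a b c (back a b x) (back b c y) a≢c)
  where
  back : ∀ a b → O′ a b → O a b
  back a b = from (O≐O′ a b)

record IsConjugate {n} (P T : SRel n) : Set where
  field
    P-irrefl   : ∀ a → ¬ P a a
    P-trans    : ∀ a b c → P a b → P b c → P a c
    T-trans    : Transitive T
    T-oriented : Oriented T
    disjoint   : ∀ a b → T a b → ¬ (P a b ⊎ P b a)
    cover      : ∀ a b → a ≢ b → P a b ⊎ P b a ⊎ T a b ⊎ T b a

reverse : ∀ {n} {P T : SRel n} → IsConjugate P T → IsConjugate P (flip T)
reverse C = record
  { P-irrefl   = P-irrefl
  ; P-trans    = P-trans
  ; T-trans    = λ a b c x y a≢c → T-trans c b a y x (a≢c ∘ sym)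
  ; T-oriented = λ a b x y → T-oriented b a x y
  ; disjoint   = λ a b t → disjoint b a t ∘ swap
  ; cover      = λ a b a≢b → map₂ (map₂ swap) (cover a b a≢b)
  }
  where open IsConjugate C

opposite : ∀ {n} {P T : SRel n} → IsConjugate P T → IsConjugate (flip P) (flip T)
opposite C = record
  { P-irrefl   = P-irrefl
  ; P-trans    = λ a b c x y → P-trans c b a y x
  ; T-trans    = λ a b c x y a≢c → T-trans c b a y x (a≢c ∘ sym)
  ; T-oriented = λ a b x y → T-oriented b a x y
  ; disjoint   = λ a b t → disjoint b a t
  ; cover      = λ a b a≢b → cover b a (a≢b ∘ sym)
  }
  where open IsConjugate C

module _ {n} {P T : SRel n} (C : IsConjugate P T) where
  open IsConjugate C

  conjugate-step : ∀ {a b c} → P a b → T b c → P a c ⊎ T a c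
  conjugate-step {a} {b} {c} p t with a ≟ c
  ... | yes refl = ⊥-elim (disjoint b a t (inj₂ p))
  ... | no a≢c with cover a c a≢c
  ...   | inj₁ pac = inj₁ pac
  ...   | inj₂ (inj₁ pca) = ⊥-elim (disjoint b c t (inj₂ (P-trans c a b pca p)))
  ...   | inj₂ (inj₂ (inj₁ tac)) = inj₂ tac
  ...   | inj₂ (inj₂ (inj₂ tca)) = ⊥-elim (disjoint b a (T-trans b c a t tca b≢a) (inj₂ p))
    where
    b≢a : b ≢ a
    b≢a b≡a = P-irrefl a (subst (P a) b≡a p)

union-linear : ∀ {n} {P T : SRel n} → IsConjugate P T →
  IsStrictLinearOrder (λ a b → P a b ⊎ T a b)
union-linear {P = P} {T} C = irrefl , trans′ , total
  where
  open IsConjugate C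
  irrefl : ∀ a → ¬ (P a a ⊎ T a a)
  irrefl a (inj₁ p) = P-irrefl a p
  irrefl a (inj₂ t) = T-oriented a a t t
  trans′ : ∀ a b c → P a b ⊎ T a b → P b c ⊎ T b c → P a c ⊎ T a c
  trans′ a b c (inj₁ p) (inj₁ q) = inj₁ (P-trans a b c p q)
  trans′ a b c (inj₁ p) (inj₂ t) = conjugate-step C p t
  trans′ a b c (inj₂ t) (inj₁ p) = conjugate-step (opposite C) p t
  trans′ a b c (inj₂ s) (inj₂ t) with a ≟ c
  ... | yes refl = ⊥-elim (T-oriented a b s t)
  ... | no a≢c = inj₂ (T-trans a b c s t a≢c)
  total : ∀ a b → a ≢ b → (P a b ⊎ T a b) ⊎ (P b a ⊎ T b a)
  total a b a≢b with cover a b a≢b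
  ... | inj₁ p = inj₁ (inj₁ p)
  ... | inj₂ (inj₁ p) = inj₂ (inj₁ p)
  ... | inj₂ (inj₂ (inj₁ t)) = inj₁ (inj₂ t)
  ... | inj₂ (inj₂ (inj₂ t)) = inj₂ (inj₂ t)

-- A decidable strict partial order with a decidable conjugate is 2-dimensional:
-- it is the intersection of the linear orders P ∪ T and P ∪ T⁻¹.
conjugate⇒twoDimensional : ∀ {n} {P T : SRel n} →
  (∀ a b → Dec (P a b)) → (∀ a b → Dec (T a b)) →
  IsConjugate P T → TwoDimensional P
conjugate⇒twoDimensional {P = P} {T} P? T? C =
    toBRel L₁? , toBRel L₂?
  , linearOrder-resp (Ed-toBRel L₁?) (union-linear C)
  , linearOrder-resp (Ed-toBRel L₂?) (union-linear (reverse C))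
  , λ a b → mk⇔ (λ p → to (Ed-toBRel L₁? a b) (inj₁ p) , to (Ed-toBRel L₂? a b) (inj₁ p))
                (λ (x , y) → meet (from (Ed-toBRel L₁? a b) x) (from (Ed-toBRel L₂? a b) y))
  where
  L₁? : ∀ a b → Dec (P a b ⊎ T a b)
  L₁? a b = P? a b ⊎-dec T? a b
  L₂? : ∀ a b → Dec (P a b ⊎ T b a)
  L₂? a b = P? a b ⊎-dec T? b a
  meet : ∀ {a b} → P a b ⊎ T a b → P a b ⊎ T b a → P a b
  meet (inj₁ p) _ = p
  meet (inj₂ _) (inj₁ p) = p
  meet {a} {b} (inj₂ s) (inj₂ t) = ⊥-elim (IsConjugate.T-oriented C a b s t)

twoDimensional⇒complementOrientable : ∀ {n} {S : SRel n} →
  TwoDimensional S → TransitivelyOrientable (Compl S)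
twoDimensional⇒complementOrientable {n} {S}
  (L₁ , L₂ , (irr₁ , tr₁ , tot₁) , (irr₂ , tr₂ , tot₂) , S⇔) =
    toBRel O?
  , transitiveOrientation-resp (Ed-toBRel O?) ((O⊆Compl , oriented , maximal) , transitive)
  where
  O : SRel n
  O a b = Ed L₁ a b × Ed L₂ b a
  O? : ∀ a b → Dec (O a b)
  O? a b = Ed? L₁ a b ×-dec Ed? L₂ b a
  O⊆Compl : O ⊆ Compl S
  O⊆Compl a b (l₁ , l₂) = (λ { refl → irr₁ a l₁ }) , λ
    { (inj₁ s) → irr₂ a (tr₂ a b a (proj₂ (to (S⇔ a b) s)) l₂)
    ; (inj₂ s) → irr₁ a (tr₁ a b a l₁ (proj₁ (to (S⇔ b a) s))) }
  oriented : Oriented O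
  oriented a b (l₁ , _) (l₁′ , _) = irr₁ a (tr₁ a b a l₁ l₁′)
  -- Every complement edge is ordered oppositely by L₁ and L₂; so O already
  -- contains one of its two directions, and an oriented F ⊇ O cannot add the other.
  maximal : ∀ F → O ⊆ F → F ⊆ Compl S → Oriented F → F ⊆ O
  maximal F O⊆F F⊆Compl F-oriented a b f with F⊆Compl a b f
  ... | a≢b , incomparable with tot₁ a b a≢b | tot₂ a b a≢b
  ... | inj₁ x | inj₁ y = ⊥-elim (incomparable (inj₁ (from (S⇔ a b) (x , y))))
  ... | inj₁ x | inj₂ y = x , y
  ... | inj₂ x | inj₁ y = ⊥-elim (F-oriented a b f (O⊆F b a (x , y)))
  ... | inj₂ x | inj₂ y = ⊥-elim (incomparable (inj₂ (from (S⇔ b a) (x , y))))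
  transitive : Transitive O
  transitive a b c (p₁ , p₂) (q₁ , q₂) _ = tr₁ a b c p₁ q₁ , tr₂ c b a q₂ p₂

orientation-total : ∀ {n} {E : SRel n} (O : BRel n) → IsOrientation (Ed O) E →
  Loopless E → ∀ a b → E a b → Ed O a b ⊎ Ed O b a
orientation-total {n} {E} O (O⊆E , oriented , maximal) loopless a b e
  with Ed? O a b | Ed? O b a
... | yes oab | _ = inj₁ oab
... | no _ | yes oba = inj₂ oba
... | no ¬oab | no ¬oba =
  ⊥-elim (¬oab (maximal F (λ _ _ → inj₁) F⊆E F-oriented a b (inj₂ (refl , refl))))
  where
  F : SRel n
  F x y = Ed O x y ⊎ (x ≡ a × y ≡ b)
  F⊆E : F ⊆ E
  F⊆E x y (inj₁ o) = O⊆E x y o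
  F⊆E x y (inj₂ (refl , refl)) = e
  F-oriented : Oriented F
  F-oriented x y (inj₁ o) (inj₁ o′) = oriented x y o o′
  F-oriented x y (inj₁ o) (inj₂ (refl , refl)) = ¬oba o
  F-oriented x y (inj₂ (refl , refl)) (inj₁ o) = ¬oba o
  F-oriented x y (inj₂ (refl , refl)) (inj₂ (refl , _)) = loopless a e

Compl-loopless : ∀ {n} (R : SRel n) → Loopless (Compl R)
Compl-loopless R a (a≢a , _) = a≢a refl

Compl-antitone : ∀ {n} {R R′ : SRel n} → R ⊆ R′ → Compl R′ ⊆ Compl R
Compl-antitone R⊆R′ a b (a≢b , incomparable) =
  a≢b , incomparable ∘ map-⊎ (R⊆R′ a b) (R⊆R′ b a)

Compl-sym : ∀ {n} {R : SRel n} {a b} → Compl R a b → Compl R b a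
Compl-sym (a≢b , incomparable) = a≢b ∘ sym , incomparable ∘ swap

closure-least : ∀ {n} {Q R : SRel n} → Transitive R → Q ⊆ R → TransClosure Q ⊆ R
closure-least R-trans Q⊆R a b (step q) = Q⊆R a b q
closure-least R-trans Q⊆R a c (trans {b = b} p q a≢c) =
  R-trans a b c (closure-least R-trans Q⊆R a b p) (closure-least R-trans Q⊆R b c q) a≢c

append : ∀ {n} {H : SRel n} {a b c} → Walk H a b → Walk H b c → Walk H a c
append (edge h) w = cons h w
append (cons h w₁) w = cons h (append w₁ w)

closure⇒walk : ∀ {n} {H : SRel n} {a b} → TransClosure H a b → Walk H a b
closure⇒walk (step h) = edge h
closure⇒walk (trans p q _) = append (closure⇒walk p) (closure⇒walk q)

-- Closing a walk between distinct vertices: cut it at its first visit to the end.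
walk⇒closure : ∀ {n} {H : SRel n} {a b} → Walk H a b → a ≢ b → TransClosure H a b
walk⇒closure (edge h) _ = step h
walk⇒closure {b = c} (cons {b = z} h w) a≢c with z ≟ c
... | yes refl = step h
... | no z≢c = trans (step h) (walk⇒closure w z≢c) a≢c

closure⇔walk : ∀ {n} {H : SRel n} {a b} →
  TransClosure H a b ⇔ (H a b ⊎ (a ≢ b × Walk H a b))
closure⇔walk = mk⇔ forth back
  where
  forth : ∀ {n} {H : SRel n} {a b} → TransClosure H a b → H a b ⊎ (a ≢ b × Walk H a b)
  forth (step h) = inj₁ h
  forth p@(trans _ _ a≢c) = inj₂ (a≢c , closure⇒walk p)
  back : ∀ {n} {H : SRel n} {a b} → H a b ⊎ (a ≢ b × Walk H a b) → TransClosure H a b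
  back (inj₁ h) = step h
  back (inj₂ (a≢b , w)) = walk⇒closure w a≢b

-- Warshall's algorithm: reachability in a decidable graph on Fin n is decidable.
module Warshall {n} {H : SRel n} (H? : ∀ a b → Dec (H a b)) where

  -- W k a b: a walk from a to b all of whose inner vertices have index < k.
  W : ℕ → SRel n
  W zero a b = H a b
  W (suc k) a b = W k a b ⊎ Σ (Fin n) λ v → toℕ v ≡ k × W k a v × W k v b

  W? : ∀ k a b → Dec (W k a b)
  W? zero a b = H? a b
  W? (suc k) a b =
    W? k a b ⊎-dec any? (λ v → (toℕ v ℕ.≟ k) ×-dec (W? k a v ×-dec W? k v b))

  sound : ∀ k {a b} → W k a b → Walk H a b
  sound zero h = edge h
  sound (suc k) (inj₁ w) = sound k w
  sound (suc k) (inj₂ (_ , _ , w₁ , w₂)) = append (sound k w₁) (sound k w₂)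

  edgeW : ∀ k {a b} → H a b → W k a b
  edgeW zero h = h
  edgeW (suc k) h = inj₁ (edgeW k h)

  dropEnd : ∀ k {a b} → toℕ b ≡ k → W (suc k) a b → W k a b
  dropEnd k e (inj₁ w) = w
  dropEnd k {a} e (inj₂ (v , v≡k , w₁ , _)) =
    subst (W k a) (toℕ-injective (≡-trans v≡k (sym e))) w₁

  dropStart : ∀ k {a b} → toℕ a ≡ k → W (suc k) a b → W k a b
  dropStart k e (inj₁ w) = w
  dropStart k {b = b} e (inj₂ (v , v≡k , _ , w₂)) =
    subst (λ x → W k x b) (toℕ-injective (≡-trans v≡k (sym e))) w₂

  concat : ∀ k a b c → toℕ b < k → W k a b → W k b c → W k a c
  concat (suc k) a b c b<1+k x y with m<1+n⇒m<n∨m≡n b<1+k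
  ... | inj₂ b≡k = inj₂ (b , b≡k , dropEnd k b≡k x , dropStart k b≡k y)
  ... | inj₁ b<k with x | y
  ... | inj₁ x′ | inj₁ y′ = inj₁ (concat k a b c b<k x′ y′)
  ... | inj₁ x′ | inj₂ (v , v≡k , y₁ , y₂) = inj₂ (v , v≡k , concat k a b v b<k x′ y₁ , y₂)
  ... | inj₂ (v , v≡k , x₁ , x₂) | inj₁ y′ = inj₂ (v , v≡k , x₁ , concat k v b c b<k x₂ y′)
  ... | inj₂ (v , v≡k , x₁ , _) | inj₂ (u , u≡k , _ , y₂) =
    inj₂ (v , v≡k , x₁ , subst (λ z → W k z c) (toℕ-injective (≡-trans u≡k (sym v≡k))) y₂)

  complete : ∀ {a b} → Walk H a b → W n a b
  complete (edge h) = edgeW n h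
  complete (cons h w) = concat n _ _ _ (toℕ<n _) (edgeW n h) (complete w)

  walk? : ∀ a b → Dec (Walk H a b)
  walk? a b = map-dec (mk⇔ (sound n) complete) (W? n a b)

closure? : ∀ {n} {H : SRel n} → (∀ a b → Dec (H a b)) → ∀ a b → Dec (TransClosure H a b)
closure? H? a b =
  map-dec (mk⇔ (from closure⇔walk) (to closure⇔walk))
    (H? a b ⊎-dec (¬? (a ≟ b) ×-dec Warshall.walk? H? a b))

module Refinement {n} (G HS : BRel n)
  (G-irrefl : ∀ a → ¬ Ed G a a)
  (G-trans : ∀ a b c → Ed G a b → Ed G b c → Ed G a c)
  (HS-trans : Transitive (Ed HS)) (HS-oriented : Oriented (Ed HS))
  (HS-total : ∀ a b → Compl (Ed G) a b → Ed HS a b ⊎ Ed HS b a) where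

  H : SRel n
  H = Hof G HS

  H* : SRel n
  H* = TransClosure H

  S′ : SRel n
  S′ = S′of G HS

  H-total : ∀ {a b} → Compl (Ed G) a b → H a b ⊎ H b a
  H-total {a} {b} c with HS-total a b c
  ... | inj₁ hs = inj₁ (hs , c)
  ... | inj₂ hs = inj₂ (hs , Compl-sym {R = Ed G} c)

  G-asym : ∀ a b → Ed G a b → ¬ Ed G b a
  G-asym a b g g′ = G-irrefl a (G-trans a b a g g′)

  H*⊆HS : H* ⊆ Ed HS
  H*⊆HS = closure-least HS-trans (λ _ _ → proj₁)

  H? : ∀ a b → Dec (H a b)
  H? a b = Ed? HS a b ×-dec (¬? (a ≟ b) ×-dec ¬? (Ed? G a b ⊎-dec Ed? G b a))

  H*? : ∀ a b → Dec (H* a b)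
  H*? = closure? H?

  S′? : ∀ a b → Dec (S′ a b)
  S′? a b = Ed? G a b ×-dec ¬? (H*? a b ⊎-dec H*? b a)

  module Sweep {K : SRel n} (K? : ∀ a b → Dec (K a b))
    (K-trans : ∀ a b c → K a b → K b c → K a c)
    (K⊆G : ∀ a b → K a b → Ed G a b ⊎ Ed G b a)
    (G⊆K : ∀ a b → Ed G a b → K a b ⊎ K b a) where

    K-incomparable : ∀ {y b} → y ≢ b → ¬ K y b → ¬ K b y → Compl (Ed G) y b
    K-incomparable y≢b ¬kyb ¬kby = y≢b , λ
      { (inj₁ g) → [ ¬kyb , ¬kby ] (G⊆K _ _ g)
      ; (inj₂ g) → [ ¬kby , ¬kyb ] (G⊆K _ _ g) }

    -- An H-step from below b lands at b, again below b, or H-adjacent to b: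
    -- it cannot land above b, since then x <K y would make x, y G-comparable.
    step-below : ∀ {x y b} → H x y → K x b → y ≡ b ⊎ K y b ⊎ H y b ⊎ H b y
    step-below {x} {y} {b} (_ , _ , incomparable) kxb with y ≟ b | K? y b | K? b y
    ... | yes y≡b | _ | _ = inj₁ y≡b
    ... | no _ | yes kyb | _ = inj₂ (inj₁ kyb)
    ... | no _ | no _ | yes kby = ⊥-elim (incomparable (K⊆G x y (K-trans x b y kxb kby)))
    ... | no y≢b | no ¬kyb | no ¬kby = inj₂ (inj₂ (H-total (K-incomparable y≢b ¬kyb ¬kby)))

    walk-below : ∀ {x y b} → Walk H x y → K x b → K y b ⊎ Walk H x b ⊎ Walk H b y
    walk-below (edge h) kxb with step-below h kxb
    ... | inj₁ refl = inj₂ (inj₁ (edge h))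
    ... | inj₂ (inj₁ kyb) = inj₁ kyb
    ... | inj₂ (inj₂ (inj₁ hyb)) = inj₂ (inj₁ (cons h (edge hyb)))
    ... | inj₂ (inj₂ (inj₂ hby)) = inj₂ (inj₂ (edge hby))
    walk-below (cons h w) kxb with step-below h kxb
    ... | inj₁ refl = inj₂ (inj₁ (edge h))
    ... | inj₂ (inj₂ (inj₁ hzb)) = inj₂ (inj₁ (cons h (edge hzb)))
    ... | inj₂ (inj₂ (inj₂ hbz)) = inj₂ (inj₂ (cons hbz w))
    ... | inj₂ (inj₁ kzb) with walk-below w kzb
    ...   | inj₁ kyb = inj₁ kyb
    ...   | inj₂ (inj₁ wzb) = inj₂ (inj₁ (cons h wzb))
    ...   | inj₂ (inj₂ wby) = inj₂ (inj₂ wby)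

  module Upward = Sweep (Ed? G) G-trans (λ _ _ → inj₁) (λ _ _ → inj₁)
  module Downward = Sweep (λ a b → Ed? G b a) (λ a b c x y → G-trans c b a y x)
                          (λ _ _ → inj₂) (λ _ _ → inj₂)

  G-neq : ∀ {a b} → Ed G a b → a ≢ b
  G-neq {a} g refl = G-irrefl a g

  -- S' is transitive: an H-walk between a and c (in either direction) would,
  -- swept against b, yield a G-cycle or an H*-edge inside (a, b) or (b, c).
  S′-trans : ∀ a b c → S′ a b → S′ b c → S′ a c
  S′-trans a b c (gab , ¬H*ab) (gbc , ¬H*bc) = G-trans a b c gab gbc , λ
    { (inj₁ h*ac) → up (Upward.walk-below (closure⇒walk h*ac) gab)
    ; (inj₂ h*ca) → down (Downward.walk-below (closure⇒walk h*ca) gbc) }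
    where
    up : Ed G c b ⊎ Walk H a b ⊎ Walk H b c → ⊥
    up (inj₁ gcb) = G-asym b c gbc gcb
    up (inj₂ (inj₁ w)) = ¬H*ab (inj₁ (walk⇒closure w (G-neq gab)))
    up (inj₂ (inj₂ w)) = ¬H*bc (inj₁ (walk⇒closure w (G-neq gbc)))
    down : Ed G b a ⊎ Walk H c b ⊎ Walk H b a → ⊥
    down (inj₁ gba) = G-asym a b gab gba
    down (inj₂ (inj₁ w)) = ¬H*bc (inj₂ (walk⇒closure w (G-neq gbc ∘ sym)))
    down (inj₂ (inj₂ w)) = ¬H*ab (inj₂ (walk⇒closure w (G-neq gab ∘ sym)))

  -- Any two distinct vertices are related by S' or H* in some direction:
  -- G-comparable pairs not in U(H*) lie in S', incomparable ones are in H.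
  S′-H*-cover : ∀ a b → a ≢ b → S′ a b ⊎ S′ b a ⊎ H* a b ⊎ H* b a
  S′-H*-cover a b a≢b with H*? a b | H*? b a | Ed? G a b | Ed? G b a
  ... | yes h*ab | _ | _ | _ = inj₂ (inj₂ (inj₁ h*ab))
  ... | no _ | yes h*ba | _ | _ = inj₂ (inj₂ (inj₂ h*ba))
  ... | no ¬h*ab | no ¬h*ba | yes gab | _ = inj₁ (gab , [ ¬h*ab , ¬h*ba ])
  ... | no ¬h*ab | no ¬h*ba | no _ | yes gba = inj₂ (inj₁ (gba , [ ¬h*ba , ¬h*ab ]))
  ... | no ¬h*ab | no ¬h*ba | no ¬gab | no ¬gba =
    ⊥-elim ([ ¬h*ab ∘ step , ¬h*ba ∘ step ] (H-total (a≢b , [ ¬gab , ¬gba ])))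

  H*-conjugate : IsConjugate S′ H*
  H*-conjugate = record
    { P-irrefl   = λ a → G-irrefl a ∘ proj₁
    ; P-trans    = S′-trans
    ; T-trans    = λ a b c → trans
    ; T-oriented = λ a b x y → HS-oriented a b (H*⊆HS a b x) (H*⊆HS b a y)
    ; disjoint   = λ a b h* → [ (λ s → proj₂ s (inj₁ h*)) , (λ s → proj₂ s (inj₂ h*)) ]
    ; cover      = S′-H*-cover
    }

  S′-twoDimensional : TwoDimensional S′
  S′-twoDimensional = conjugate⇒twoDimensional S′? H*? H*-conjugate

  -- S ⊆ S' whenever S ⊆ G and H_S avoids S: U(H*) ⊆ U(H_S) misses S.
  ⊆S′ : (S : SRel n) → S ⊆ Ed G → Ed HS ⊆ Compl S → S ⊆ S′
  ⊆S′ S S⊆G HS⊆Compl a b s = S⊆G a b s , λ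
    { (inj₁ h*) → proj₂ (HS⊆Compl a b (H*⊆HS a b h*)) (inj₁ s)
    ; (inj₂ h*) → proj₂ (HS⊆Compl b a (H*⊆HS b a h*)) (inj₂ s) }

lemma11 : (n : ℕ) (G S : BRel n) →
    Loopless (Ed G) → Transitive (Ed G) → Acyclic (Ed G) →
    (Ed S ⊆ Ed G) → TwoDimensional (Ed S) →
    TransitivelyOrientable (Compl (Ed S)) ×
    ((HS : BRel n) → IsTransitiveOrientation (Ed HS) (Compl (Ed S)) →
      TwoDimensional (S′of G HS) × (Ed S ⊆ S′of G HS))
lemma11 n G S G-irrefl G-trans G-acyclic S⊆G S-twoDimensional =
  twoDimensional⇒complementOrientable S-twoDimensional , refinement
  where
  -- In an acyclic graph the side condition a ≢ c of transitivity always holds.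
  G-trans′ : ∀ a b c → Ed G a b → Ed G b c → Ed G a c
  G-trans′ a b c gab gbc =
    G-trans a b c gab gbc λ { refl → G-acyclic a (cons gab (edge gbc)) }
  refinement : (HS : BRel n) → IsTransitiveOrientation (Ed HS) (Compl (Ed S)) →
    TwoDimensional (S′of G HS) × (Ed S ⊆ S′of G HS)
  refinement HS (HS-orientation@(HS⊆Compl , HS-oriented , _) , HS-trans) =
    R.S′-twoDimensional , R.⊆S′ (Ed S) S⊆G HS⊆Compl
    where
    HS-total : ∀ a b → Compl (Ed G) a b → Ed HS a b ⊎ Ed HS b a
    HS-total a b c = orientation-total HS HS-orientation (Compl-loopless (Ed S)) a b
                       (Compl-antitone S⊆G a b c)
    module R = Refinement G HS G-irrefl G-trans′ HS-trans HS-oriented HS-total
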